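{- Let $T$ be an out-star (a centre vertex $c$ with arcs $c\to \ell_1,\dots,c\to\ell_n$ to its leaves, $n\ge 1$) carrying a \textsc{blocking pebbles} position with only blue and red pebbles. Let $b_c\ge 0$ be the number of blue pebbles on $c$ and $b_\ell\ge 0$ the total number of blue pebbles on the leaves; define $r_c$ and $r_\ell$ similarly for red. Then: (1) if $T$ carries at least one pebble and all its pebbles are blue, the game value of $T$ is $3b_\ell-2+2b_c$; (2) if the centre carries at least one blue pebble and no red pebbles, some collection of leaves carries at least one blue pebble in total, and some other collection of leaves carries at least one red pebble in total, the game value of $T$ is $3b_\ell-2+2(b_c-1)$; (3) if the centre carries no pebbles, and there is exactly one blue pebble on a leaf and exactly one red pebble on a leaf (possibly the same leaf), with no other pebbles, the game value of $T$ is $*$; (4) if the centre carries no pebbles, some collection of leaves carries two or more blue pebbles in total, and exactly one red pebble lies on some other leaf, the game value of $T$ is $\{3(b_\ell-1)-2\mid 0\}$; (5) if the centre carries no pebbles, some collection of leaves carries at least two blue pebbles in total, and some other collection of leaves carries at least two red pebbles in total, the game value of $T$ is $\{3(b_\ell-1)-2\mid -(3(r_\ell-1)-2)\}$.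
   Context: \textsc{Blocking pebbles}: a position is a finite directed acyclic graph with, at each vertex, numbers of blue, red and green pebbles (here no green pebbles). An in-neighbour of $v$ is $u$ with an arc $u\to v$; an out-neighbour is $w$ with an arc $v\to w$. Left, from a chosen vertex $v$, either (1) moves a positive number of her pebbles (blue or green) from $v$ to a single in-neighbour of $v$ at no cost, or (2) removes two of her pebbles from $v$ and places one pebble on an out-neighbour of $v$. No blue pebble may be moved onto a vertex currently carrying a red pebble. Right has the symmetric moves with red (and green) pebbles, and no red pebble may be moved onto a vertex carrying a blue pebble. Normal play (last player to move wins). Values are combinatorial game values in Conway's sense; $*=\{0\mid 0\}$. -}

module Defs where

open import Data.Nat using (ℕ; zero; suc; _+_; _*_; _∸_; _≡ᵇ_; _≤ᵇ_)
open import Data.Integer using (ℤ; +_; -[1+_])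
open import Data.Fin using (Fin; zero; suc; _≟_)
open import Data.Bool using (Bool; true; false; if_then_else_; _∧_)
open import Data.List using (List; []; _∷_; [_]; _++_; map; concatMap; allFin; upTo; length; lookup)
open import Data.Nat.ListAction using (sum)
open import Data.Product using (_×_; ∃)
open import Data.Sum using (_⊎_)
open import Relation.Nullary using (does)
open import Relation.Binary.PropositionalEquality using (_≡_)

data Game : Set where
  game : (nl : ℕ) → (Fin nl → Game) → (nr : ℕ) → (Fin nr → Game) → Game

⟨_∣_⟩ : List Game → List Game → Game
⟨ Ls ∣ Rs ⟩ = game (length Ls) (lookup Ls) (length Rs) (lookup Rs)

-- Conway's order.  G ≤G H  iff  no G^L satisfies H ≤ G^L and no H^R satisfies H^R ≤ G.
-- G ⧏ H is (constructively, positively) the statement ¬ (H ≤G G).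
mutual
  _≤G_ : Game → Game → Set
  game _ GL _ GR ≤G H@(game _ HL _ HR) =
    (∀ i → GL i ⧏ H) × (∀ j → game _ GL _ GR ⧏ HR j)

  _⧏_ : Game → Game → Set
  G@(game _ GL _ GR) ⧏ game _ HL _ HR =
    (∃ λ i → G ≤G HL i) ⊎ (∃ λ j → GR j ≤G game _ HL _ HR)

infix 4 _≤G_ _⧏_ _≈G_

_≈G_ : Game → Game → Set
G ≈G H = (G ≤G H) × (H ≤G G)

negG : Game → Game
negG (game nl L nr R) = game nr (λ j → negG (R j)) nl (λ i → negG (L i))

zeroG : Game
zeroG = ⟨ [] ∣ [] ⟩

starG : Game
starG = ⟨ [ zeroG ] ∣ [ zeroG ] ⟩

natG : ℕ → Game
natG zero    = zeroG
natG (suc n) = ⟨ [ natG n ] ∣ [] ⟩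

intG : ℤ → Game
intG (+ n)      = natG n
intG -[1+ n ]   = negG (natG (suc n))

-- Blocking pebbles on a finite directed graph with vertex set Fin m.
-- arc u v = true  means there is an arc u → v.
-- A position (with no green pebbles) is a pair of pebble counts
-- (blue, red) : (Fin m → ℕ) × (Fin m → ℕ).

update : ∀ {m} → (Fin m → ℕ) → Fin m → ℕ → (Fin m → ℕ)
update f v n x = if does (x ≟ v) then n else f x

-- All configurations of the mover's pebbles (M) reachable in one move,
-- given the opponent's pebbles (O).  The mover may not move a pebble onto
-- a vertex currently carrying an opponent pebble.
moves : ∀ {m} → (Fin m → Fin m → Bool) → (M O : Fin m → ℕ) → List (Fin m → ℕ)
moves {m} arc M O =
  concatMap (λ v → concatMap (λ u → slides v u ++ placements v u) (allFin m)) (allFin m)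
  where
  -- (1) move k ≥ 1 pebbles (k ≤ M v) from v to an in-neighbour u of v
  slides : Fin m → Fin m → List (Fin m → ℕ)
  slides v u =
    if arc u v ∧ (O u ≡ᵇ 0)
    then map (λ k → update (update M v (M v ∸ suc k)) u (M u + suc k)) (upTo (M v))
    else []
  placements : Fin m → Fin m → List (Fin m → ℕ)
  placements v w =
    if arc v w ∧ (O w ≡ᵇ 0) ∧ (2 ≤ᵇ M v)
    then [ update (update M v (M v ∸ 2)) w (M w + 1) ]
    else []

-- Game tree of a position, unfolded to depth `fuel` (an exhausted fuel
-- gives the empty game; it is only used with sufficient fuel, see starGame).
gameOf : ∀ {m} → ℕ → (Fin m → Fin m → Bool) → (B R : Fin m → ℕ) → Game
gameOf zero       arc B R = zeroG
gameOf (suc fuel) arc B R =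
  ⟨ map (λ B′ → gameOf fuel arc B′ R) (moves arc B R)
  ∣ map (λ R′ → gameOf fuel arc B R′) (moves arc R B) ⟩

-- Out-star with n leaves: vertex zero is the centre c, vertex suc i is
-- the leaf ℓ_{i+1}; arcs are exactly c → ℓ_i.

starArc : ∀ {n} → Fin (suc n) → Fin (suc n) → Bool
starArc zero    (suc _) = true
starArc zero    zero    = false
starArc (suc _) _       = false

centre : ∀ {n} → (Fin (suc n) → ℕ) → ℕ
centre f = f zero

leafTotal : ∀ {n} → (Fin (suc n) → ℕ) → ℕ
leafTotal {n} f = sum (map (λ i → f (suc i)) (allFin n))

-- Every move strictly decreases  2·(pebbles on c) + 3·(pebbles on leaves),
-- so this fuel suffices to unfold the complete game tree.
starFuel : ∀ {n} → (B R : Fin (suc n) → ℕ) → ℕ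
starFuel B R = suc (2 * (centre B + centre R) + 3 * (leafTotal B + leafTotal R))

starGame : ∀ n → (B R : Fin (suc n) → ℕ) → Game
starGame n B R = gameOf (starFuel B R) (starArc {n}) B R

-- No leaf carries both a blue and a red pebble (the leaves carrying blue
-- pebbles and the leaves carrying red pebbles form disjoint collections).
LeavesSeparated : ∀ {n} → (B R : Fin (suc n) → ℕ) → Set
LeavesSeparated {n} B R = ∀ (i : Fin n) → (B (suc i) ≡ 0) ⊎ (R (suc i) ≡ 0)

-- Every move lowers the potential 2·(pebbles on the centre) + 3·(pebbles on the leaves) of the
-- mover's colour, and the mover can always lower it by exactly one: slide a single pebble from a
-- leaf to the centre or, with empty leaves, place a pebble on a free leaf. So when only Left can
-- move, the value is the potential minus a constant: pot − 2 with no red pebbles, and pot − 4 once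
-- blue holds the centre, which freezes red. With both centres empty every move is a slide to the
-- centre, reaching the previous situation for the mover; with leaf totals b and r this gives
-- {3b − 5 ∣ −(3r − 5)}, Right's side being Left's with the colours exchanged, which negates the
-- game. The induction carries an invariant (Admissible) providing the free leaf a placement needs.

module Submission where

open import Defs

module Conway where

  open import Data.Nat using (zero; suc; _≤_; _<_; s≤s)
  open import Data.Fin using (zero)
  open import Data.Empty using (⊥; ⊥-elim)
  open import Data.Product using (_×_; _,_; ∃; proj₁; proj₂)
  open import Data.Sum using (inj₁; inj₂)
  open import Data.List using (List; [_]; map)
  open import Data.List.Membership.Propositional using (_∈_)
  open import Data.List.Membership.Propositional.Properties using (∈-lookup; ∈-map⁺; ∈-map⁻)
  open import Data.List.Relation.Unary.Any using (index)
  open import Data.List.Relation.Unary.Any.Properties using (lookup-index)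
  open import Relation.Binary.PropositionalEquality using (_≡_; refl; sym)

  infix 4 _∈ᴸ_ _∈ᴿ_

  _∈ᴸ_ : Game → Game → Set
  K ∈ᴸ game _ L _ _ = ∃ λ i → L i ≡ K

  _∈ᴿ_ : Game → Game → Set
  K ∈ᴿ game _ _ _ R = ∃ λ j → R j ≡ K

  ≤G-intro : ∀ {G H} → (∀ {K} → K ∈ᴸ G → K ⧏ H) → (∀ {K} → K ∈ᴿ H → G ⧏ K) → G ≤G H
  ≤G-intro {game _ _ _ _} {game _ _ _ _} below above = (λ i → below (i , refl)) , (λ j → above (j , refl))

  ⧏-left : ∀ {G H K} → K ∈ᴸ H → G ≤G K → G ⧏ H
  ⧏-left {game _ _ _ _} {game _ _ _ _} (i , refl) G≤K = inj₁ (i , G≤K)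

  ⧏-right : ∀ {G H K} → K ∈ᴿ G → K ≤G H → G ⧏ H
  ⧏-right {game _ _ _ _} {game _ _ _ _} (j , refl) K≤H = inj₂ (j , K≤H)

  ≤G-refl : ∀ G → G ≤G G
  ≤G-refl (game _ L _ R) =
    (λ i → ⧏-left (i , refl) (≤G-refl (L i))) , (λ j → ⧏-right (j , refl) (≤G-refl (R j)))

  mutual
    ≤G-trans : ∀ {G H K} → G ≤G H → H ≤G K → G ≤G K
    ≤G-trans {game _ _ _ _} {game _ _ _ _} {game _ _ _ _} G≤H@(GL⧏H , _) H≤K@(_ , H⧏KR) =
      (λ i → ⧏-≤G-trans (GL⧏H i) H≤K) , (λ j → ≤G-⧏-trans G≤H (H⧏KR j))

    ≤G-⧏-trans : ∀ {G H K} → G ≤G H → H ⧏ K → G ⧏ K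
    ≤G-⧏-trans {game _ _ _ _} {game _ _ _ _} {game _ _ _ _} G≤H (inj₁ (i , H≤KL)) =
      inj₁ (i , ≤G-trans G≤H H≤KL)
    ≤G-⧏-trans {game _ _ _ _} {game _ _ _ _} {game _ _ _ _} (_ , G⧏HR) (inj₂ (j , HR≤K)) =
      ⧏-≤G-trans (G⧏HR j) HR≤K

    ⧏-≤G-trans : ∀ {G H K} → G ⧏ H → H ≤G K → G ⧏ K
    ⧏-≤G-trans {game _ _ _ _} {game _ _ _ _} {game _ _ _ _} (inj₁ (i , G≤HL)) (HL⧏K , _) =
      ≤G-⧏-trans G≤HL (HL⧏K i)
    ⧏-≤G-trans {game _ _ _ _} {game _ _ _ _} {game _ _ _ _} (inj₂ (j , GR≤H)) H≤K =
      inj₂ (j , ≤G-trans GR≤H H≤K)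

  ≈G-refl : ∀ G → G ≈G G
  ≈G-refl G = ≤G-refl G , ≤G-refl G

  ≈G-trans : ∀ {G H K} → G ≈G H → H ≈G K → G ≈G K
  ≈G-trans (G≤H , H≤G) (H≤K , K≤H) = ≤G-trans G≤H H≤K , ≤G-trans K≤H H≤G

  mutual
    negG-antitone : ∀ {G H} → G ≤G H → negG H ≤G negG G
    negG-antitone {game _ _ _ _} {game _ _ _ _} (GL⧏H , G⧏HR) =
      (λ j → negG-⧏ (G⧏HR j)) , (λ i → negG-⧏ (GL⧏H i))

    negG-⧏ : ∀ {G H} → G ⧏ H → negG H ⧏ negG G
    negG-⧏ {game _ _ _ _} {game _ _ _ _} (inj₁ (i , G≤HL)) = inj₂ (i , negG-antitone G≤HL)
    negG-⧏ {game _ _ _ _} {game _ _ _ _} (inj₂ (j , GR≤H)) = inj₁ (j , negG-antitone GR≤H)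

  negG-cong : ∀ {G H} → G ≈G H → negG G ≈G negG H
  negG-cong (G≤H , H≤G) = negG-antitone H≤G , negG-antitone G≤H

  ∈ᴸ-⟨map⟩⁻ : ∀ {A : Set} {g : A → Game} {xs Rs K} → K ∈ᴸ ⟨ map g xs ∣ Rs ⟩ →
    ∃ λ x → x ∈ xs × K ≡ g x
  ∈ᴸ-⟨map⟩⁻ (i , refl) = ∈-map⁻ _ (∈-lookup i)

  ∈ᴸ-⟨map⟩⁺ : ∀ {A : Set} {g : A → Game} {xs Rs x} → x ∈ xs → g x ∈ᴸ ⟨ map g xs ∣ Rs ⟩
  ∈ᴸ-⟨map⟩⁺ {g = g} x∈ = index (∈-map⁺ g x∈) , sym (lookup-index (∈-map⁺ g x∈))

  ∈ᴿ-⟨map⟩⁻ : ∀ {A : Set} {h : A → Game} {Ls ys K} → K ∈ᴿ ⟨ Ls ∣ map h ys ⟩ →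
    ∃ λ y → y ∈ ys × K ≡ h y
  ∈ᴿ-⟨map⟩⁻ (j , refl) = ∈-map⁻ _ (∈-lookup j)

  ∈ᴿ-⟨map⟩⁺ : ∀ {A : Set} {h : A → Game} {Ls ys y} → y ∈ ys → h y ∈ᴿ ⟨ Ls ∣ map h ys ⟩
  ∈ᴿ-⟨map⟩⁺ {h = h} y∈ = index (∈-map⁺ h y∈) , sym (lookup-index (∈-map⁺ h y∈))

  ∈ᴸ-negG⁻ : ∀ {G K} → K ∈ᴸ negG G → ∃ λ K′ → K′ ∈ᴿ G × negG K′ ≡ K
  ∈ᴸ-negG⁻ {game _ _ _ R} (j , refl) = R j , (j , refl) , refl

  ∈ᴿ-negG⁻ : ∀ {G K} → K ∈ᴿ negG G → ∃ λ K′ → K′ ∈ᴸ G × negG K′ ≡ K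
  ∈ᴿ-negG⁻ {game _ L _ _} (i , refl) = L i , (i , refl) , refl

  ∈ᴿ⇒negG∈ᴸ : ∀ {G K} → K ∈ᴿ G → negG K ∈ᴸ negG G
  ∈ᴿ⇒negG∈ᴸ {game _ _ _ _} (j , refl) = j , refl

  ∈ᴸ⇒negG∈ᴿ : ∀ {G K} → K ∈ᴸ G → negG K ∈ᴿ negG G
  ∈ᴸ⇒negG∈ᴿ {game _ _ _ _} (i , refl) = i , refl

  ≈G-byOptions : ∀ {G H} →
    (∀ {K} → K ∈ᴸ G → ∃ λ K′ → K′ ∈ᴸ H × K ≈G K′) →
    (∀ {K′} → K′ ∈ᴸ H → ∃ λ K → K ∈ᴸ G × K ≈G K′) →
    (∀ {K} → K ∈ᴿ G → ∃ λ K′ → K′ ∈ᴿ H × K ≈G K′) →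
    (∀ {K′} → K′ ∈ᴿ H → ∃ λ K → K ∈ᴿ G × K ≈G K′) →
    G ≈G H
  ≈G-byOptions GL HL GR HR =
    ≤G-intro (λ K∈ → let _ , K′∈ , K≈K′ = GL K∈ in ⧏-left K′∈ (proj₁ K≈K′))
             (λ K′∈ → let _ , K∈ , K≈K′ = HR K′∈ in ⧏-right K∈ (proj₁ K≈K′)) ,
    ≤G-intro (λ K′∈ → let _ , K∈ , K≈K′ = HL K′∈ in ⧏-left K∈ (proj₂ K≈K′))
             (λ K∈ → let _ , K′∈ , K≈K′ = GR K∈ in ⧏-right K′∈ (proj₂ K≈K′))

  ⟨map⟩≈negG⟨map⟩ : ∀ {A C : Set} {g g′ : A → Game} {h h′ : C → Game}
    (xs : List A) (ys : List C) →
    (∀ x → g′ x ≈G negG (g x)) → (∀ y → h′ y ≈G negG (h y)) →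
    ⟨ map h′ ys ∣ map g′ xs ⟩ ≈G negG ⟨ map g xs ∣ map h ys ⟩
  ⟨map⟩≈negG⟨map⟩ {g = g} {g′} {h} {h′} xs ys g′≈ h′≈ =
    ≈G-byOptions {G} {H} left left⁻¹ right right⁻¹
    where
    G P H : Game
    G = ⟨ map h′ ys ∣ map g′ xs ⟩
    P = ⟨ map g xs ∣ map h ys ⟩
    H = negG P
    left : ∀ {K} → K ∈ᴸ G → ∃ λ K′ → K′ ∈ᴸ H × K ≈G K′
    left K∈ with ∈ᴸ-⟨map⟩⁻ {g = h′} {ys} {map g′ xs} K∈
    ... | y , y∈ , refl = _ , ∈ᴿ⇒negG∈ᴸ {P} (∈ᴿ-⟨map⟩⁺ {Ls = map g xs} y∈) , h′≈ y
    left⁻¹ : ∀ {K′} → K′ ∈ᴸ H → ∃ λ K → K ∈ᴸ G × K ≈G K′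
    left⁻¹ K′∈ with ∈ᴸ-negG⁻ {P} K′∈
    ... | _ , K∈ , refl with ∈ᴿ-⟨map⟩⁻ {h = h} {map g xs} {ys} K∈
    ...   | y , y∈ , refl = _ , ∈ᴸ-⟨map⟩⁺ {Rs = map g′ xs} y∈ , h′≈ y
    right : ∀ {K} → K ∈ᴿ G → ∃ λ K′ → K′ ∈ᴿ H × K ≈G K′
    right K∈ with ∈ᴿ-⟨map⟩⁻ {h = g′} {map h′ ys} {xs} K∈
    ... | x , x∈ , refl = _ , ∈ᴸ⇒negG∈ᴿ {P} (∈ᴸ-⟨map⟩⁺ {Rs = map h ys} x∈) , g′≈ x
    right⁻¹ : ∀ {K′} → K′ ∈ᴿ H → ∃ λ K → K ∈ᴿ G × K ≈G K′
    right⁻¹ K′∈ with ∈ᴿ-negG⁻ {P} K′∈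
    ... | _ , K∈ , refl with ∈ᴸ-⟨map⟩⁻ {g = g} {xs} {map h ys} K∈
    ...   | x , x∈ , refl = _ , ∈ᴿ-⟨map⟩⁺ {Ls = map h′ ys} x∈ , g′≈ x

  natG-noRight : ∀ m {K} → K ∈ᴿ natG m → ⊥
  natG-noRight zero    (() , _)
  natG-noRight (suc m) (() , _)

  natG-mono : ∀ {a b} → a ≤ b → natG a ≤G natG b
  natG-mono {zero}  {b} _ = ≤G-intro {zeroG} {natG b} (λ ()) (λ K∈ → ⊥-elim (natG-noRight b K∈))
  natG-mono {suc a} {suc b} (s≤s a≤b) =
    ≤G-intro {natG (suc a)} {natG (suc b)}
      (λ { (zero , refl) → ⧏-left {natG a} {natG (suc b)} (zero , refl) (natG-mono a≤b) })
      (λ K∈ → ⊥-elim (natG-noRight (suc b) K∈))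

  natG-⧏ : ∀ {a b} → a < b → natG a ⧏ natG b
  natG-⧏ {a} {suc b} (s≤s a≤b) = ⧏-left {natG a} {natG (suc b)} (zero , refl) (natG-mono a≤b)

  negG-natG≤natG : ∀ a b → negG (natG a) ≤G natG b
  negG-natG≤natG a b =
    ≤G-intro {negG (natG a)} {natG b}
      (λ K∈ → let _ , K′∈ , _ = ∈ᴸ-negG⁻ {natG a} K∈ in ⊥-elim (natG-noRight a K′∈))
      (λ K∈ → ⊥-elim (natG-noRight b K∈))

  ≈natG-intro : ∀ G m → (∀ {K} → K ∈ᴿ G → ⊥) → (∀ {K} → K ∈ᴸ G → K ⧏ natG m) →
    (∀ {m′} → m ≡ suc m′ → ∃ λ K → K ∈ᴸ G × natG m′ ≤G K) → G ≈G natG m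
  ≈natG-intro G m noRight below best =
    ≤G-intro {G} {natG m} below (λ K∈ → ⊥-elim (natG-noRight m K∈)) ,
    ≤G-intro {natG m} {G} (above m best) (λ K∈ → ⊥-elim (noRight K∈))
    where
    above : ∀ m → (∀ {m′} → m ≡ suc m′ → ∃ λ K → K ∈ᴸ G × natG m′ ≤G K) →
      ∀ {K} → K ∈ᴸ natG m → K ⧏ G
    above (suc m′) best (zero , refl) = let _ , K∈ , m′≤K = best refl in ⧏-left {natG m′} {G} K∈ m′≤K

  ≈⟨∣⟩-intro : ∀ G a b →
    (∀ {K} → K ∈ᴸ G → K ⧏ ⟨ [ a ] ∣ [ b ] ⟩) →
    (∀ {K} → K ∈ᴿ G → ⟨ [ a ] ∣ [ b ] ⟩ ⧏ K) →
    a ⧏ G → G ⧏ b → G ≈G ⟨ [ a ] ∣ [ b ] ⟩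
  ≈⟨∣⟩-intro G a b below above a⧏G G⧏b =
    ≤G-intro {G} {⟨ [ a ] ∣ [ b ] ⟩} below (λ { (zero , refl) → G⧏b }) ,
    ≤G-intro {⟨ [ a ] ∣ [ b ] ⟩} {G} (λ { (zero , refl) → a⧏G }) above

  ⟨∣⟩-cong : ∀ {a a′ b b′} → a ≈G a′ → b ≈G b′ →
    ⟨ [ a ] ∣ [ b ] ⟩ ≈G ⟨ [ a′ ] ∣ [ b′ ] ⟩
  ⟨∣⟩-cong {a} {a′} {b} {b′} (a≤a′ , a′≤a) (b≤b′ , b′≤b) =
    ≈⟨∣⟩-intro ⟨ [ a ] ∣ [ b ] ⟩ a′ b′
      (λ { (zero , refl) → ⧏-left {a} {⟨ [ a′ ] ∣ [ b′ ] ⟩} (zero , refl) a≤a′ })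
      (λ { (zero , refl) → ⧏-right {⟨ [ a′ ] ∣ [ b′ ] ⟩} {b} (zero , refl) b′≤b })
      (⧏-left {a′} {⟨ [ a ] ∣ [ b ] ⟩} (zero , refl) a′≤a)
      (⧏-right {⟨ [ a ] ∣ [ b ] ⟩} {b′} (zero , refl) b≤b′)

module Star where

  open Conway
  open import Data.Nat
    using (ℕ; zero; suc; pred; _+_; _*_; _∸_; _≤_; _<_; z≤n; s≤s; _≡ᵇ_; _≤ᵇ_)
  open import Data.Nat.Properties hiding (suc-injective)
  open import Data.Nat.ListAction using (sum)
  open import Data.Nat.Tactic.RingSolver using (solve-∀)
  open import Data.Fin using (Fin; zero; suc)
  open import Data.Fin.Properties using (suc-injective) renaming (_≟_ to _≟ᶠ_)
  open import Data.Bool using (Bool; true; T; if_then_else_; _∧_)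
  open import Data.Bool.Properties using (T-∧)
  open import Data.Unit using (tt)
  open import Data.Empty using (⊥-elim)
  open import Data.Product using (_×_; _,_; ∃)
  import Data.Product
  open import Data.Sum using (_⊎_; inj₁; inj₂; swap)
  import Data.Sum
  open import Data.List using (List; []; [_]; map; allFin; upTo; tabulate)
  open import Data.List.Properties using (map-tabulate; tabulate-cong)
  open import Data.List.Membership.Propositional using (_∈_; lose; find)
  open import Data.List.Membership.Propositional.Properties
  open import Data.List.Relation.Unary.Any using (here)
  open import Function.Base using (_∘_)
  open import Function.Bundles using (Equivalence)
  open import Relation.Nullary using (yes; no)
  open import Relation.Binary.PropositionalEquality hiding ([_])
  open ≡-Reasoning

  gameOf-swap : ∀ f {m} (arc : Fin m → Fin m → Bool) (B R : Fin m → ℕ) →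
    gameOf f arc R B ≈G negG (gameOf f arc B R)
  gameOf-swap zero    arc B R = ((λ ()) , (λ ())) , ((λ ()) , (λ ()))
  gameOf-swap (suc f) arc B R =
    ⟨map⟩≈negG⟨map⟩ {g = λ B′ → gameOf f arc B′ R} {λ B′ → gameOf f arc R B′}
                    {λ R′ → gameOf f arc B R′} {λ R′ → gameOf f arc R′ B}
      (moves arc B R) (moves arc R B) (λ B′ → gameOf-swap f arc B′ R) (λ R′ → gameOf-swap f arc B R′)

  afterSlide : ∀ {n} → (Fin (suc n) → ℕ) → Fin n → ℕ → Fin (suc n) → ℕ
  afterSlide M i k = update (update M (suc i) (M (suc i) ∸ suc k)) zero (M zero + suc k)

  afterPlace : ∀ {n} → (Fin (suc n) → ℕ) → Fin n → Fin (suc n) → ℕ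
  afterPlace M w = update (update M zero (M zero ∸ 2)) (suc w) (M (suc w) + 1)

  -- On the out-star the centre is the only in-neighbour of a leaf and has no in-neighbour itself,
  -- so a move either slides k+1 pebbles from a leaf onto the centre or places one on a leaf.
  data Move {n} (M O : Fin (suc n) → ℕ) : (Fin (suc n) → ℕ) → Set where
    slide : ∀ i k → O zero ≡ 0 → k < M (suc i) → Move M O (afterSlide M i k)
    place : ∀ w → O (suc w) ≡ 0 → 2 ≤ M zero → Move M O (afterPlace M w)

  private
    ∈-if⁻ : ∀ {A : Set} b {xs : List A} {x} → x ∈ (if b then xs else []) → T b × x ∈ xs
    ∈-if⁻ true x∈ = tt , x∈

  ∈moves⇒Move : ∀ {n} (M O x : Fin (suc n) → ℕ) → x ∈ moves starArc M O → Move M O x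
  ∈moves⇒Move {n} M O x x∈ with find (∈-concatMap⁻ _ {xs = allFin (suc n)} x∈)
  ... | v , _ , x∈v with find (∈-concatMap⁻ _ {xs = allFin (suc n)} x∈v)
  ∈moves⇒Move M O x _ | suc i , _ , _ | zero , _ , x∈vu
    with ∈-++⁻ (if O zero ≡ᵇ 0 then map (afterSlide M i) (upTo (M (suc i))) else []) x∈vu
  ... | inj₂ ()
  ... | inj₁ x∈slides with ∈-if⁻ (O zero ≡ᵇ 0) x∈slides
  ...   | free , x∈′ with ∈-map⁻ (afterSlide M i) x∈′
  ...     | k , k∈ , refl = slide i k (≡ᵇ⇒≡ _ _ free) (∈-upTo⁻ k∈)
  ∈moves⇒Move M O x _ | zero , _ , _ | suc w , _ , x∈vu
    with ∈-if⁻ ((O (suc w) ≡ᵇ 0) ∧ (2 ≤ᵇ M zero)) {[ afterPlace M w ]} x∈vu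
  ... | legal , here refl with Equivalence.to T-∧ legal
  ...   | free , two = place w (≡ᵇ⇒≡ _ _ free) (≤ᵇ⇒≤ 2 _ two)
  ∈moves⇒Move M O x _ | zero  , _ , _ | zero  , _ , ()
  ∈moves⇒Move M O x _ | suc _ , _ , _ | suc _ , _ , ()

  Move⇒∈moves : ∀ {n} {M O x : Fin (suc n) → ℕ} → Move M O x → x ∈ moves starArc M O
  Move⇒∈moves {n} {M} {O} (slide i k free k<) =
    ∈-concatMap⁺ _ {xs = allFin (suc n)} (lose (∈-allFin (suc i))
      (∈-concatMap⁺ _ {xs = allFin (suc n)} (lose (∈-allFin zero)
        (∈-++⁺ˡ {xs = if O zero ≡ᵇ 0 then map (afterSlide M i) (upTo (M (suc i))) else []} slid))))
    where
    slid : afterSlide M i k ∈ (if O zero ≡ᵇ 0 then map (afterSlide M i) (upTo (M (suc i))) else [])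
    slid rewrite free = ∈-map⁺ (afterSlide M i) (∈-upTo⁺ k<)
  Move⇒∈moves {n} {M} {O} (place w free two) =
    ∈-concatMap⁺ _ {xs = allFin (suc n)} (lose (∈-allFin zero)
      -- the centre-to-centre entry has already reduced to [], leaving the leaves (tabulate suc)
      (∈-concatMap⁺ _ {xs = tabulate suc} (lose (∈-tabulate⁺ w) (∈-++⁺ʳ [] placed))))
    where
    placed : afterPlace M w ∈ (if (O (suc w) ≡ᵇ 0) ∧ (2 ≤ᵇ M zero) then [ afterPlace M w ] else [])
    placed rewrite free with 2 ≤ᵇ M zero | ≤⇒≤ᵇ two
    ... | true | _ = here refl

  update-same : ∀ {m} (f : Fin m → ℕ) v a → update f v a v ≡ a
  update-same f v a with v ≟ᶠ v
  ... | yes _  = refl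
  ... | no v≢v = ⊥-elim (v≢v refl)

  update-other : ∀ {m} (f : Fin m → ℕ) {v x} a → x ≢ v → update f v a x ≡ f x
  update-other f {v} {x} a x≢v with x ≟ᶠ v
  ... | yes x≡v = ⊥-elim (x≢v x≡v)
  ... | no _    = refl

  afterSlide-leaf : ∀ {n} (M : Fin (suc n) → ℕ) i k → afterSlide M i k (suc i) ≡ M (suc i) ∸ suc k
  afterSlide-leaf M i k = update-same M (suc i) _

  afterSlide-otherLeaf : ∀ {n} (M : Fin (suc n) → ℕ) {i j} k → j ≢ i →
    afterSlide M i k (suc j) ≡ M (suc j)
  afterSlide-otherLeaf M k j≢i = update-other M _ (λ sj≡si → j≢i (suc-injective sj≡si))

  afterPlace-leaf : ∀ {n} (M : Fin (suc n) → ℕ) w → afterPlace M w (suc w) ≡ M (suc w) + 1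
  afterPlace-leaf M w = update-same (update M zero (M zero ∸ 2)) (suc w) _

  afterPlace-otherLeaf : ∀ {n} (M : Fin (suc n) → ℕ) {w j} → j ≢ w →
    afterPlace M w (suc j) ≡ M (suc j)
  afterPlace-otherLeaf M j≢w =
    update-other (update M zero (M zero ∸ 2)) _ (λ sj≡sw → j≢w (suc-injective sj≡sw))

  sum-tabulate-update : ∀ {n} (h h′ : Fin n → ℕ) i → (∀ j → j ≢ i → h′ j ≡ h j) →
    sum (tabulate h′) + h i ≡ sum (tabulate h) + h′ i
  sum-tabulate-update h h′ zero agree = begin
    (h′ zero + sum (tabulate (h′ ∘ suc))) + h zero  ≡⟨ cong (λ s → (h′ zero + s) + h zero) rest ⟩
    (h′ zero + sum (tabulate (h ∘ suc))) + h zero   ≡⟨ exchange (h′ zero) _ (h zero) ⟩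
    (h zero + sum (tabulate (h ∘ suc))) + h′ zero   ∎
    where
    rest : sum (tabulate (h′ ∘ suc)) ≡ sum (tabulate (h ∘ suc))
    rest = cong sum (tabulate-cong (λ j → agree (suc j) (λ ())))
    exchange : ∀ a s b → (a + s) + b ≡ (b + s) + a
    exchange = solve-∀
  sum-tabulate-update h h′ (suc i) agree = begin
    (h′ zero + sum (tabulate (h′ ∘ suc))) + h (suc i)  ≡⟨ cong (λ a → a + _ + h (suc i)) (agree zero (λ ())) ⟩
    (h zero + sum (tabulate (h′ ∘ suc))) + h (suc i)   ≡⟨ +-assoc (h zero) _ _ ⟩
    h zero + (sum (tabulate (h′ ∘ suc)) + h (suc i))   ≡⟨ cong (h zero +_) rest ⟩
    h zero + (sum (tabulate (h ∘ suc)) + h′ (suc i))   ≡⟨ +-assoc (h zero) _ _ ⟨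
    (h zero + sum (tabulate (h ∘ suc))) + h′ (suc i)   ∎
    where
    rest : sum (tabulate (h′ ∘ suc)) + h (suc i) ≡ sum (tabulate (h ∘ suc)) + h′ (suc i)
    rest = sum-tabulate-update (h ∘ suc) (h′ ∘ suc) i
             (λ j j≢i → agree (suc j) (λ sj≡si → j≢i (suc-injective sj≡si)))

  sum-tabulate-positive : ∀ {n} (h : Fin n → ℕ) → 1 ≤ sum (tabulate h) → ∃ λ i → 1 ≤ h i
  sum-tabulate-positive {suc n} h 1≤sum with h zero in h₀
  ... | suc _ = zero , subst (1 ≤_) (sym h₀) (s≤s z≤n)
  ... | zero  = let i , 1≤hi = sum-tabulate-positive (h ∘ suc) 1≤sum in suc i , 1≤hi

  leafTotal-tabulate : ∀ {n} (f : Fin (suc n) → ℕ) → leafTotal f ≡ sum (tabulate (f ∘ suc))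
  leafTotal-tabulate f = cong sum (map-tabulate (λ i → i) (f ∘ suc))

  leafTotal-update : ∀ {n} (M x : Fin (suc n) → ℕ) i → (∀ j → j ≢ i → x (suc j) ≡ M (suc j)) →
    leafTotal x + M (suc i) ≡ leafTotal M + x (suc i)
  leafTotal-update M x i agree rewrite leafTotal-tabulate M | leafTotal-tabulate x =
    sum-tabulate-update (M ∘ suc) (x ∘ suc) i agree

  occupiedLeaf : ∀ {n} (f : Fin (suc n) → ℕ) → 1 ≤ leafTotal f → ∃ λ i → 1 ≤ f (suc i)
  occupiedLeaf f 1≤ℓ = sum-tabulate-positive (f ∘ suc) (subst (1 ≤_) (leafTotal-tabulate f) 1≤ℓ)

  noLeaves⊎occupiedLeaf : ∀ {n} (f : Fin (suc n) → ℕ) → leafTotal f ≡ 0 ⊎ ∃ λ i → 1 ≤ f (suc i)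
  noLeaves⊎occupiedLeaf f with leafTotal f in ℓ
  ... | zero  = inj₁ refl
  ... | suc _ = inj₂ (occupiedLeaf f (subst (1 ≤_) (sym ℓ) (s≤s z≤n)))

  leafTotal-afterSlide : ∀ {n} (M : Fin (suc n) → ℕ) i k → k < M (suc i) →
    leafTotal (afterSlide M i k) + suc k ≡ leafTotal M
  leafTotal-afterSlide {n} M i k k< = +-cancelʳ-≡ (M (suc i) ∸ suc k) _ _ (begin
    leafTotal x + suc k + (M (suc i) ∸ suc k)    ≡⟨ +-assoc (leafTotal x) (suc k) _ ⟩
    leafTotal x + (suc k + (M (suc i) ∸ suc k))  ≡⟨ cong (leafTotal x +_) (m+[n∸m]≡n k<) ⟩
    leafTotal x + M (suc i)                       ≡⟨ leafTotal-update M x i (λ j → afterSlide-otherLeaf M k) ⟩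
    leafTotal M + x (suc i)                       ≡⟨ cong (leafTotal M +_) (afterSlide-leaf M i k) ⟩
    leafTotal M + (M (suc i) ∸ suc k)             ∎)
    where
    x : Fin (suc n) → ℕ
    x = afterSlide M i k

  leafTotal-afterPlace : ∀ {n} (M : Fin (suc n) → ℕ) w → leafTotal (afterPlace M w) ≡ suc (leafTotal M)
  leafTotal-afterPlace {n} M w = +-cancelʳ-≡ (M (suc w)) _ _ (begin
    leafTotal x + M (suc w)        ≡⟨ leafTotal-update M x w (λ j → afterPlace-otherLeaf M) ⟩
    leafTotal M + x (suc w)        ≡⟨ cong (leafTotal M +_) (trans (afterPlace-leaf M w) (+-comm (M (suc w)) 1)) ⟩
    leafTotal M + suc (M (suc w))  ≡⟨ +-suc (leafTotal M) (M (suc w)) ⟩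
    suc (leafTotal M) + M (suc w)  ∎)
    where
    x : Fin (suc n) → ℕ
    x = afterPlace M w

  count-afterSlide : ∀ {n} (M : Fin (suc n) → ℕ) i k → k < M (suc i) →
    centre (afterSlide M i k) + leafTotal (afterSlide M i k) ≡ centre M + leafTotal M
  count-afterSlide {n} M i k k< = begin
    (M zero + suc k) + leafTotal x  ≡⟨ +-assoc (M zero) (suc k) _ ⟩
    M zero + (suc k + leafTotal x)  ≡⟨ cong (M zero +_) (+-comm (suc k) _) ⟩
    M zero + (leafTotal x + suc k)  ≡⟨ cong (M zero +_) (leafTotal-afterSlide M i k k<) ⟩
    M zero + leafTotal M            ∎
    where
    x : Fin (suc n) → ℕ
    x = afterSlide M i k

  afterSlide-centre : ∀ {n} (M : Fin (suc n) → ℕ) i k → 1 ≤ centre (afterSlide M i k)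
  afterSlide-centre M i k = ≤-trans (s≤s z≤n) (m≤n+m (suc k) (M zero))

  afterPlace-leaves : ∀ {n} (M : Fin (suc n) → ℕ) w → 1 ≤ leafTotal (afterPlace M w)
  afterPlace-leaves M w = subst (1 ≤_) (sym (leafTotal-afterPlace M w)) (s≤s z≤n)

  ∸-pred : ∀ {p q} d {m} → suc p ≡ q → q ∸ d ≡ suc m → p ∸ d ≡ m
  ∸-pred {p} d refl e = trans (sym (pred[m∸n]≡m∸[1+n] (suc p) d)) (cong pred e)

  ∸-shift : ∀ {p q} k d → suc k + p ≡ q → p ∸ d ≤ q ∸ suc d
  ∸-shift {p} k d refl = ∸-monoˡ-≤ d (m≤n+m p k)

  pot : ∀ {n} → (Fin (suc n) → ℕ) → ℕ
  pot f = 2 * centre f + 3 * leafTotal f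

  pot-lowerBound : ∀ {n} (f : Fin (suc n) → ℕ) {a b} → a ≤ centre f → b ≤ leafTotal f →
    2 * a + 3 * b ≤ pot f
  pot-lowerBound f a≤c b≤ℓ = +-mono-≤ (*-monoʳ-≤ 2 a≤c) (*-monoʳ-≤ 3 b≤ℓ)

  2≤pot : ∀ {n} (f : Fin (suc n) → ℕ) → 1 ≤ centre f + leafTotal f → 2 ≤ pot f
  2≤pot f 1≤pebbles with centre f ≟ 0
  ... | no c≢0  = pot-lowerBound f (n≢0⇒n>0 c≢0) z≤n
  ... | yes c≡0 =
    ≤-trans (n≤1+n 2) (pot-lowerBound f z≤n (subst (λ c → 1 ≤ c + leafTotal f) c≡0 1≤pebbles))

  4≤pot : ∀ {n} (f : Fin (suc n) → ℕ) → 1 ≤ centre f → 1 ≤ leafTotal f → 4 ≤ pot f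
  4≤pot f 1≤c 1≤ℓ = ≤-trans (n≤1+n 4) (pot-lowerBound f 1≤c 1≤ℓ)

  centre-large : ∀ {n} (f : Fin (suc n) → ℕ) d → leafTotal f ≡ 0 → 1 ≤ pot f ∸ 2 * d → d < centre f
  centre-large f d ℓ≡0 1≤ =
    *-cancelˡ-< 2 d (centre f) (m∸n≢0⇒n<m (m<n⇒n≢0 (subst (λ p → 1 ≤ p ∸ 2 * d) potℓ≡0 1≤)))
    where
    potℓ≡0 : pot f ≡ 2 * centre f
    potℓ≡0 = trans (cong (λ ℓ → 2 * centre f + 3 * ℓ) ℓ≡0) (+-identityʳ (2 * centre f))

  pot-afterSlide : ∀ {n} (M : Fin (suc n) → ℕ) i k → k < M (suc i) → suc k + pot (afterSlide M i k) ≡ pot M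
  pot-afterSlide {n} M i k k< = begin
    suc k + (2 * (M zero + suc k) + 3 * leafTotal x)
      ≡⟨ regroup (M zero) (leafTotal x) (suc k) ⟩
    2 * M zero + 3 * (leafTotal x + suc k)
      ≡⟨ cong (λ ℓ → 2 * M zero + 3 * ℓ) (leafTotal-afterSlide M i k k<) ⟩
    pot M
      ∎
    where
    x : Fin (suc n) → ℕ
    x = afterSlide M i k
    regroup : ∀ c ℓ s → s + (2 * (c + s) + 3 * ℓ) ≡ 2 * c + 3 * (ℓ + s)
    regroup = solve-∀

  pot-afterPlace : ∀ {n} (M : Fin (suc n) → ℕ) w → 2 ≤ M zero → suc (pot (afterPlace M w)) ≡ pot M
  pot-afterPlace {n} M w 2≤c = begin
    suc (2 * (M zero ∸ 2) + 3 * leafTotal x)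
      ≡⟨ cong (λ ℓ → suc (2 * (M zero ∸ 2) + 3 * ℓ)) (leafTotal-afterPlace M w) ⟩
    suc (2 * (M zero ∸ 2) + 3 * suc (leafTotal M))
      ≡⟨ regroup (M zero ∸ 2) (leafTotal M) ⟩
    2 * (M zero ∸ 2 + 2) + 3 * leafTotal M
      ≡⟨ cong (λ c → 2 * c + 3 * leafTotal M) (m∸n+n≡m 2≤c) ⟩
    pot M
      ∎
    where
    x : Fin (suc n) → ℕ
    x = afterPlace M w
    regroup : ∀ c ℓ → suc (2 * c + 3 * suc ℓ) ≡ 2 * (c + 2) + 3 * ℓ
    regroup = solve-∀

  pot-move : ∀ {n} {M O x : Fin (suc n) → ℕ} → Move M O x → pot x < pot M
  pot-move {M = M} (slide i k _ k<) = ≤-trans (s≤s (m≤n+m _ k)) (≤-reflexive (pot-afterSlide M i k k<))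
  pot-move {M = M} (place w _ 2≤c)  = ≤-reflexive (pot-afterPlace M w 2≤c)

  2≤pot-move : ∀ {n} {M O x : Fin (suc n) → ℕ} → Move M O x → 2 ≤ pot x
  2≤pot-move {M = M} (slide i k _ _) = pot-lowerBound (afterSlide M i k) (afterSlide-centre M i k) z≤n
  2≤pot-move {M = M} (place w _ _) =
    ≤-trans (n≤1+n 2) (pot-lowerBound (afterPlace M w) z≤n (afterPlace-leaves M w))

  separated-occupied : ∀ {n} {M O : Fin (suc n) → ℕ} → LeavesSeparated M O →
    ∀ {i} → 1 ≤ M (suc i) → O (suc i) ≡ 0
  separated-occupied sep {i} 1≤Mi with sep i
  ... | inj₁ Mi≡0 = ⊥-elim (m<n⇒n≢0 1≤Mi Mi≡0)
  ... | inj₂ Oi≡0 = Oi≡0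

  separated-update : ∀ {n} {M x O : Fin (suc n) → ℕ} i → LeavesSeparated M O → O (suc i) ≡ 0 →
    (∀ j → j ≢ i → x (suc j) ≡ M (suc j)) → LeavesSeparated x O
  separated-update i sep Oi≡0 agree j with j ≟ᶠ i
  ... | yes refl = inj₂ Oi≡0
  ... | no j≢i rewrite agree j j≢i = sep j

  Sparse : ∀ {n} → (Fin (suc n) → ℕ) → Set
  Sparse f = centre f + leafTotal f ≤ 1

  -- The sparse alternative covers part (3), whose two pebbles may share a leaf.
  record Admissible {n} (B R : Fin (suc n) → ℕ) : Set where
    field
      centreFree : centre B ≡ 0 ⊎ centre R ≡ 0
      bluePlaceable : 2 ≤ centre B → ∃ λ i → R (suc i) ≡ 0
      redPlaceable : 2 ≤ centre R → ∃ λ i → B (suc i) ≡ 0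
      separatedOrSparse : LeavesSeparated B R ⊎ (Sparse B × Sparse R)

  admissible-swap : ∀ {n} {B R : Fin (suc n) → ℕ} → Admissible B R → Admissible R B
  admissible-swap adm = record
    { centreFree = swap centreFree
    ; bluePlaceable = redPlaceable
    ; redPlaceable = bluePlaceable
    ; separatedOrSparse = Data.Sum.map (λ sep i → swap (sep i)) Data.Product.swap separatedOrSparse
    }
    where open Admissible adm

  admissible-move : ∀ {n} {M O x : Fin (suc n) → ℕ} → Admissible M O → Move M O x → Admissible x O
  admissible-move {n} {M} {O} adm (slide i k Oc≡0 k<) = record
    { centreFree = inj₂ Oc≡0
    ; bluePlaceable = placeable separatedOrSparse
    ; redPlaceable = λ 2≤Oc → ⊥-elim (m<n⇒n≢0 2≤Oc Oc≡0)
    ; separatedOrSparse = Data.Sum.map separated sparse separatedOrSparse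
    }
    where
    open Admissible adm
    x : Fin (suc n) → ℕ
    x = afterSlide M i k
    occupied : 1 ≤ M (suc i)
    occupied = ≤-trans (s≤s z≤n) k<
    placeable : LeavesSeparated M O ⊎ (Sparse M × Sparse O) → 2 ≤ centre x → ∃ λ j → O (suc j) ≡ 0
    placeable (inj₁ sep) _ = i , separated-occupied {M = M} {O} sep occupied
    placeable (inj₂ (sparseM , _)) 2≤xc =
      ⊥-elim (<⇒≱ 2≤xc (≤-trans (m≤m+n _ _) (subst (_≤ 1) (sym (count-afterSlide M i k k<)) sparseM)))
    separated : LeavesSeparated M O → LeavesSeparated x O
    separated sep = separated-update {M = M} {x} {O} i sep (separated-occupied {M = M} {O} sep occupied)
                      (λ j → afterSlide-otherLeaf M k)
    sparse : Sparse M × Sparse O → Sparse x × Sparse O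
    sparse (sparseM , sparseO) = subst (_≤ 1) (sym (count-afterSlide M i k k<)) sparseM , sparseO
  admissible-move {M = M} {O} adm (place w Ow≡0 2≤Mc) = record
    { centreFree = inj₂ Oc≡0
    ; bluePlaceable = λ 2≤xc → bluePlaceable (≤-trans 2≤xc (m∸n≤m (M zero) 2))
    ; redPlaceable = λ 2≤Oc → ⊥-elim (m<n⇒n≢0 2≤Oc Oc≡0)
    ; separatedOrSparse = inj₁ (separated separatedOrSparse)
    }
    where
    open Admissible adm
    Oc≡0 : O zero ≡ 0
    Oc≡0 = Data.Sum.[ (λ Mc≡0 → ⊥-elim (m<n⇒n≢0 2≤Mc Mc≡0)) , (λ Oc≡0 → Oc≡0) ] centreFree
    separated : LeavesSeparated M O ⊎ (Sparse M × Sparse O) → LeavesSeparated (afterPlace M w) O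
    separated (inj₁ sep) =
      separated-update {M = M} {afterPlace M w} {O} w sep Ow≡0 (λ j → afterPlace-otherLeaf M)
    separated (inj₂ (sparseM , _)) = ⊥-elim (<⇒≱ 2≤Mc (m+n≤o⇒m≤o (M zero) sparseM))

module Valuation where

  open Conway
  open Star
  open import Data.Nat using (ℕ; zero; suc; _+_; _*_; _∸_; _≤_; _<_; z≤n; s≤s; s≤s⁻¹)
  open import Data.Nat.Properties
  open import Data.Fin using (Fin; zero; suc)
  open import Data.Empty using (⊥; ⊥-elim)
  open import Relation.Nullary using (yes; no)
  open import Data.Product using (_×_; _,_; ∃; proj₁; proj₂)
  open import Data.Sum using (_⊎_; inj₁; inj₂)
  import Data.Sum
  open import Data.List using ([_]; map)
  open import Data.Nat.Tactic.RingSolver using (solve-∀)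
  open import Relation.Binary.PropositionalEquality hiding ([_])

  module Position {n} (f : ℕ) (B R : Fin (suc n) → ℕ) where

    G : Game
    G = gameOf (suc f) starArc B R

    leftOption⁻ : ∀ {K} → K ∈ᴸ G → ∃ λ x → Move B R x × K ≡ gameOf f starArc x R
    leftOption⁻ K∈ =
      let x , x∈ , K≡ = ∈ᴸ-⟨map⟩⁻ {g = λ x → gameOf f starArc x R} {moves starArc B R}
                                  {map (λ y → gameOf f starArc B y) (moves starArc R B)} K∈
      in x , ∈moves⇒Move B R x x∈ , K≡

    leftOption⁺ : ∀ {x} → Move B R x → gameOf f starArc x R ∈ᴸ G
    leftOption⁺ mv =
      ∈ᴸ-⟨map⟩⁺ {Rs = map (λ y → gameOf f starArc B y) (moves starArc R B)} (Move⇒∈moves mv)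

    rightOption⁻ : ∀ {K} → K ∈ᴿ G → ∃ λ y → Move R B y × K ≡ gameOf f starArc B y
    rightOption⁻ K∈ =
      let y , y∈ , K≡ = ∈ᴿ-⟨map⟩⁻ {h = λ y → gameOf f starArc B y}
                                  {map (λ x → gameOf f starArc x R) (moves starArc B R)} {moves starArc R B} K∈
      in y , ∈moves⇒Move R B y y∈ , K≡

    rightOption⁺ : ∀ {y} → Move R B y → gameOf f starArc B y ∈ᴿ G
    rightOption⁺ mv =
      ∈ᴿ-⟨map⟩⁺ {Ls = map (λ x → gameOf f starArc x R) (moves starArc B R)} (Move⇒∈moves mv)

  allBlue-value : ∀ f {n} (B R : Fin (suc n) → ℕ) → (∀ v → R v ≡ 0) → Fin n → pot B < f →
    gameOf f starArc B R ≈G natG (pot B ∸ 2)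
  allBlue-value zero    B R noRed leaf ()
  allBlue-value (suc f) B R noRed leaf pot< = ≈natG-intro G (pot B ∸ 2) noRight below best
    where
    open Position f B R
    value : ∀ {x} → Move B R x → gameOf f starArc x R ≈G natG (pot x ∸ 2)
    value mv = allBlue-value f _ R noRed leaf (<-≤-trans (pot-move mv) (s≤s⁻¹ pot<))
    noRight : ∀ {K} → K ∈ᴿ G → ⊥
    noRight K∈ with rightOption⁻ K∈
    ... | _ , slide i k _ k< , _ = n≮0 (subst (k <_) (noRed (suc i)) k<)
    ... | _ , place _ _ 2≤Rc , _ = m<n⇒n≢0 2≤Rc (noRed zero)
    below : ∀ {K} → K ∈ᴸ G → K ⧏ natG (pot B ∸ 2)
    below K∈ with leftOption⁻ K∈
    ... | _ , mv , refl = ≤G-⧏-trans (proj₁ (value mv)) (natG-⧏ (∸-monoˡ-< (pot-move mv) (2≤pot-move mv)))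
    stepDown : ∀ {x m′} → Move B R x → suc (pot x) ≡ pot B → pot B ∸ 2 ≡ suc m′ →
      ∃ λ K → K ∈ᴸ G × natG m′ ≤G K
    stepDown mv pot≡ e =
      _ , leftOption⁺ mv , ≤G-trans (natG-mono (≤-reflexive (sym (∸-pred 2 pot≡ e)))) (proj₂ (value mv))
    best : ∀ {m′} → pot B ∸ 2 ≡ suc m′ → ∃ λ K → K ∈ᴸ G × natG m′ ≤G K
    best e with noLeaves⊎occupiedLeaf B
    ... | inj₂ (i , 1≤Bi) = stepDown (slide i 0 (noRed zero) 1≤Bi) (pot-afterSlide B i 0 1≤Bi) e
    ... | inj₁ ℓ≡0 = stepDown (place leaf (noRed (suc leaf)) 2≤Bc) (pot-afterPlace B leaf 2≤Bc) e
      where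
      2≤Bc : 2 ≤ centre B
      2≤Bc = centre-large B 1 ℓ≡0 (subst (1 ≤_) (sym e) (s≤s z≤n))

  record Values (f : ℕ) {n} (B R : Fin (suc n) → ℕ) : Set where
    field
      blueCentre : 1 ≤ centre B → 1 ≤ leafTotal R → gameOf f starArc B R ≈G natG (pot B ∸ 4)
      emptyCentres : centre B ≡ 0 → centre R ≡ 0 → 1 ≤ leafTotal B → 1 ≤ leafTotal R →
        gameOf f starArc B R ≈G ⟨ [ natG (pot B ∸ 5) ] ∣ [ negG (natG (pot R ∸ 5)) ] ⟩
  open Values public

  module Step {f n} {B R : Fin (suc n) → ℕ} (adm : Admissible B R)
              (valueL : ∀ {x} → Move B R x → Values f x R)
              (valueR : ∀ {y} → Move R B y → Values f y B) where

    open Position f B R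
    open Admissible adm

    blueCentre-value : 1 ≤ centre B → 1 ≤ leafTotal R → G ≈G natG (pot B ∸ 4)
    blueCentre-value 1≤Bc 1≤Rℓ = ≈natG-intro G (pot B ∸ 4) noRight below best
      where
      Rc≡0 : centre R ≡ 0
      Rc≡0 = Data.Sum.[ (λ Bc≡0 → ⊥-elim (m<n⇒n≢0 1≤Bc Bc≡0)) , (λ Rc≡0 → Rc≡0) ] centreFree
      value : ∀ {x} → Move B R x → 1 ≤ centre x → gameOf f starArc x R ≈G natG (pot x ∸ 4)
      value mv 1≤xc = blueCentre (valueL mv) 1≤xc 1≤Rℓ
      noRight : ∀ {K} → K ∈ᴿ G → ⊥
      noRight K∈ with rightOption⁻ K∈
      ... | _ , slide _ _ Bc≡0 _ , _ = m<n⇒n≢0 1≤Bc Bc≡0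
      ... | _ , place _ _ 2≤Rc , _ = m<n⇒n≢0 2≤Rc Rc≡0
      smaller : ∀ {x} (mv : Move B R x) → 1 ≤ centre x → 4 ≤ pot x →
        gameOf f starArc x R ⧏ natG (pot B ∸ 4)
      smaller mv 1≤xc 4≤pot =
        ≤G-⧏-trans (proj₁ (value mv 1≤xc)) (natG-⧏ (∸-monoˡ-< (pot-move mv) 4≤pot))
      option : ∀ {x} → Move B R x → gameOf f starArc x R ⧏ natG (pot B ∸ 4)
      option mv@(slide i k _ _) = smaller mv (afterSlide-centre B i k) (pot-lowerBound (afterSlide B i k) 2≤xc z≤n)
        where
        2≤xc : 2 ≤ centre (afterSlide B i k)
        2≤xc = +-mono-≤ 1≤Bc (s≤s z≤n)
      option mv@(place w _ _) with centre (afterPlace B w) ≟ 0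
      ... | no xc≢0 = smaller mv 1≤xc (4≤pot (afterPlace B w) 1≤xc (afterPlace-leaves B w))
        where
        1≤xc : 1 ≤ centre (afterPlace B w)
        1≤xc = n≢0⇒n>0 xc≢0
      ... | yes xc≡0 =
        ≤G-⧏-trans (proj₁ (emptyCentres (valueL mv) xc≡0 Rc≡0 (afterPlace-leaves B w) 1≤Rℓ))
          (⧏-right {⟨ [ natG _ ] ∣ [ negG (natG _) ] ⟩} {natG (pot B ∸ 4)} (zero , refl)
            (negG-natG≤natG _ _))
      below : ∀ {K} → K ∈ᴸ G → K ⧏ natG (pot B ∸ 4)
      below K∈ with leftOption⁻ K∈
      ... | _ , mv , refl = option mv
      stepDown : ∀ {x m′} → Move B R x → 1 ≤ centre x → suc (pot x) ≡ pot B → pot B ∸ 4 ≡ suc m′ →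
        ∃ λ K → K ∈ᴸ G × natG m′ ≤G K
      stepDown mv 1≤xc pot≡ e =
        _ , leftOption⁺ mv ,
        ≤G-trans (natG-mono (≤-reflexive (sym (∸-pred 4 pot≡ e)))) (proj₂ (value mv 1≤xc))
      best : ∀ {m′} → pot B ∸ 4 ≡ suc m′ → ∃ λ K → K ∈ᴸ G × natG m′ ≤G K
      best e with noLeaves⊎occupiedLeaf B
      ... | inj₂ (i , 1≤Bi) =
        stepDown (slide i 0 Rc≡0 1≤Bi) (afterSlide-centre B i 0) (pot-afterSlide B i 0 1≤Bi) e
      ... | inj₁ ℓ≡0 =
        let w , Rw≡0 = bluePlaceable 2≤Bc
        in stepDown (place w Rw≡0 2≤Bc) (m+n≤o⇒m≤o∸n 1 3≤Bc) (pot-afterPlace B w 2≤Bc) e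
        where
        3≤Bc : 3 ≤ centre B
        3≤Bc = centre-large B 2 ℓ≡0 (subst (1 ≤_) (sym e) (s≤s z≤n))
        2≤Bc : 2 ≤ centre B
        2≤Bc = ≤-trans (n≤1+n 2) 3≤Bc

    emptyCentres-value : centre B ≡ 0 → centre R ≡ 0 → 1 ≤ leafTotal B → 1 ≤ leafTotal R →
      G ≈G ⟨ [ natG (pot B ∸ 5) ] ∣ [ negG (natG (pot R ∸ 5)) ] ⟩
    emptyCentres-value Bc≡0 Rc≡0 1≤Bℓ 1≤Rℓ =
      ≈⟨∣⟩-intro G (natG a) (negG (natG b)) below above a⧏G G⧏b
      where
      a b : ℕ
      a = pot B ∸ 5
      b = pot R ∸ 5
      P : Game
      P = ⟨ [ natG a ] ∣ [ negG (natG b) ] ⟩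
      blueSlide : ∀ i k → k < B (suc i) →
        gameOf f starArc (afterSlide B i k) R ≈G natG (pot (afterSlide B i k) ∸ 4)
      blueSlide i k k< = blueCentre (valueL (slide i k Rc≡0 k<)) (afterSlide-centre B i k) 1≤Rℓ
      redSlide : ∀ j k → k < R (suc j) →
        gameOf f starArc B (afterSlide R j k) ≈G negG (natG (pot (afterSlide R j k) ∸ 4))
      redSlide j k k< =
        ≈G-trans (gameOf-swap f starArc (afterSlide R j k) B)
                 (negG-cong (blueCentre (valueR (slide j k Bc≡0 k<)) (afterSlide-centre R j k) 1≤Bℓ))
      below : ∀ {K} → K ∈ᴸ G → K ⧏ P
      below K∈ with leftOption⁻ K∈
      ... | _ , slide i k _ k< , refl =
        ⧏-left {_} {P} (zero , refl)
          (≤G-trans (proj₁ (blueSlide i k k<)) (natG-mono (∸-shift k 4 (pot-afterSlide B i k k<))))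
      ... | _ , place _ _ 2≤Bc , refl = ⊥-elim (m<n⇒n≢0 2≤Bc Bc≡0)
      above : ∀ {K} → K ∈ᴿ G → P ⧏ K
      above K∈ with rightOption⁻ K∈
      ... | _ , slide j k _ k< , refl =
        ⧏-right {P} {_} (zero , refl)
          (≤G-trans (negG-antitone (natG-mono (∸-shift k 4 (pot-afterSlide R j k k<))))
                    (proj₂ (redSlide j k k<)))
      ... | _ , place _ _ 2≤Rc , refl = ⊥-elim (m<n⇒n≢0 2≤Rc Rc≡0)
      a⧏G : natG a ⧏ G
      a⧏G =
        let i , 1≤Bi = occupiedLeaf B 1≤Bℓ
            a≡ = cong (_∸ 5) (sym (pot-afterSlide B i 0 1≤Bi))
        in ⧏-left {natG a} {G} (leftOption⁺ (slide i 0 Rc≡0 1≤Bi))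
             (≤G-trans (natG-mono (≤-reflexive a≡)) (proj₂ (blueSlide i 0 1≤Bi)))
      G⧏b : G ⧏ negG (natG b)
      G⧏b =
        let j , 1≤Rj = occupiedLeaf R 1≤Rℓ
            b≡ = cong (_∸ 5) (sym (pot-afterSlide R j 0 1≤Rj))
        in ⧏-right {G} {negG (natG b)} (rightOption⁺ (slide j 0 Bc≡0 1≤Rj))
             (≤G-trans (proj₁ (redSlide j 0 1≤Rj)) (negG-antitone (natG-mono (≤-reflexive b≡))))

  values : ∀ f {n} (B R : Fin (suc n) → ℕ) → Admissible B R → pot B + pot R < f → Values f B R
  values zero    B R adm ()
  values (suc f) B R adm fuel = record
    { blueCentre = blueCentre-value
    ; emptyCentres = emptyCentres-value
    }
    where
    valueL : ∀ {x} → Move B R x → Values f x R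
    valueL mv = values f _ R (admissible-move adm mv) (<-≤-trans (+-monoˡ-< (pot R) (pot-move mv)) (s≤s⁻¹ fuel))
    valueR : ∀ {y} → Move R B y → Values f y B
    valueR mv = values f _ B (admissible-move (admissible-swap adm) mv)
      (<-≤-trans (+-monoˡ-< (pot B) (pot-move mv)) (subst (_≤ f) (+-comm (pot B) (pot R)) (s≤s⁻¹ fuel)))
    open Step adm valueL valueR

  pot≤starFuel : ∀ {n} (B R : Fin (suc n) → ℕ) → pot B + pot R < starFuel B R
  pot≤starFuel B R = s≤s (≤-reflexive (regroup (centre B) (leafTotal B) (centre R) (leafTotal R)))
    where
    regroup : ∀ a b c d → (2 * a + 3 * b) + (2 * c + 3 * d) ≡ 2 * (a + c) + 3 * (b + d)
    regroup = solve-∀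

  starGame-allBlue : ∀ {n} (B R : Fin (suc n) → ℕ) → (∀ v → R v ≡ 0) → Fin n →
    starGame n B R ≈G natG (pot B ∸ 2)
  starGame-allBlue B R noRed leaf =
    allBlue-value (starFuel B R) B R noRed leaf (≤-trans (s≤s (m≤m+n (pot B) (pot R))) (pot≤starFuel B R))

  starGame-values : ∀ {n} (B R : Fin (suc n) → ℕ) → Admissible B R → Values (starFuel B R) B R
  starGame-values B R adm = values (starFuel B R) B R adm (pot≤starFuel B R)

  admissible-blueCentre : ∀ {n} {B R : Fin (suc n) → ℕ} → centre R ≡ 0 → 1 ≤ leafTotal B →
    LeavesSeparated B R → Admissible B R
  admissible-blueCentre {B = B} {R} Rc≡0 1≤Bℓ sep = record
    { centreFree = inj₂ Rc≡0
    ; bluePlaceable = λ _ → let i , 1≤Bi = occupiedLeaf B 1≤Bℓ in i , separated-occupied {M = B} {R} sep 1≤Bi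
    ; redPlaceable = λ 2≤Rc → ⊥-elim (m<n⇒n≢0 2≤Rc Rc≡0)
    ; separatedOrSparse = inj₁ sep
    }

  admissible-emptyCentres : ∀ {n} {B R : Fin (suc n) → ℕ} → centre B ≡ 0 → centre R ≡ 0 →
    LeavesSeparated B R ⊎ (Sparse B × Sparse R) → Admissible B R
  admissible-emptyCentres Bc≡0 Rc≡0 separatedOrSparse = record
    { centreFree = inj₁ Bc≡0
    ; bluePlaceable = λ 2≤Bc → ⊥-elim (m<n⇒n≢0 2≤Bc Bc≡0)
    ; redPlaceable = λ 2≤Rc → ⊥-elim (m<n⇒n≢0 2≤Rc Rc≡0)
    ; separatedOrSparse = separatedOrSparse
    }

open import Data.Nat using (ℕ; suc; _≤_) renaming (_+_ to _+ℕ_)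
open import Data.Integer using (ℤ; +_; -_; _+_; _-_; _*_)
open import Data.Fin using (Fin; zero)
open import Data.Product using (_×_; _,_)
open import Data.List using ([]; _∷_; [_])
open import Relation.Binary.PropositionalEquality
  using (_≡_; sym; trans; cong; cong₂; subst; subst₂; module ≡-Reasoning)
import Data.Nat as ℕ
import Data.Nat.Properties as ℕ
open import Data.Integer.Properties using (m-n≡m⊖n; ⊖-≥; pos-+; pos-*)
open import Data.Integer.Tactic.RingSolver using (solve-∀)
open import Data.Sum using (_⊎_; inj₁; inj₂)
open Conway using (⟨∣⟩-cong; ≈G-refl; ≈G-trans)
open Star using (pot; 2≤pot; 4≤pot; Sparse)
open Valuation
open ≡-Reasoning

+m-+n≡+[m∸n] : ∀ {m n} → n ≤ m → + m - + n ≡ + (m ℕ.∸ n)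
+m-+n≡+[m∸n] {m} {n} n≤m = trans (m-n≡m⊖n m n) (⊖-≥ n≤m)

pot-ℤ : ∀ {n} (f : Fin (suc n) → ℕ) → + pot f ≡ + 2 * + centre f + + 3 * + leafTotal f
pot-ℤ f =
  trans (pos-+ (2 ℕ.* centre f) (3 ℕ.* leafTotal f)) (cong₂ _+_ (pos-* 2 (centre f)) (pos-* 3 (leafTotal f)))

allBlue-ℤ : ∀ {n} (f : Fin (suc n) → ℕ) → 2 ≤ pot f →
  + 3 * + leafTotal f - + 2 + + 2 * + centre f ≡ + (pot f ℕ.∸ 2)
allBlue-ℤ f 2≤pot = begin
  + 3 * + leafTotal f - + 2 + + 2 * + centre f   ≡⟨ regroup (+ centre f) (+ leafTotal f) ⟩
  (+ 2 * + centre f + + 3 * + leafTotal f) - + 2 ≡⟨ cong (_- + 2) (pot-ℤ f) ⟨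
  + pot f - + 2                                  ≡⟨ +m-+n≡+[m∸n] 2≤pot ⟩
  + (pot f ℕ.∸ 2)                                ∎
  where
  regroup : ∀ c ℓ → + 3 * ℓ - + 2 + + 2 * c ≡ (+ 2 * c + + 3 * ℓ) - + 2
  regroup = solve-∀

blueCentre-ℤ : ∀ {n} (f : Fin (suc n) → ℕ) → 4 ≤ pot f →
  + 3 * + leafTotal f - + 2 + + 2 * (+ centre f - + 1) ≡ + (pot f ℕ.∸ 4)
blueCentre-ℤ f 4≤pot = begin
  + 3 * + leafTotal f - + 2 + + 2 * (+ centre f - + 1) ≡⟨ regroup (+ centre f) (+ leafTotal f) ⟩
  (+ 2 * + centre f + + 3 * + leafTotal f) - + 4       ≡⟨ cong (_- + 4) (pot-ℤ f) ⟨
  + pot f - + 4                                        ≡⟨ +m-+n≡+[m∸n] 4≤pot ⟩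
  + (pot f ℕ.∸ 4)                                      ∎
  where
  regroup : ∀ c ℓ → + 3 * ℓ - + 2 + + 2 * (c - + 1) ≡ (+ 2 * c + + 3 * ℓ) - + 4
  regroup = solve-∀

leaves-ℤ : ∀ ℓ → 2 ≤ ℓ → + 3 * (+ ℓ - + 1) - + 2 ≡ + (3 ℕ.* ℓ ℕ.∸ 5)
leaves-ℤ ℓ 2≤ℓ = begin
  + 3 * (+ ℓ - + 1) - + 2 ≡⟨ regroup (+ ℓ) ⟩
  + 3 * + ℓ - + 5         ≡⟨ cong (_- + 5) (pos-* 3 ℓ) ⟨
  + (3 ℕ.* ℓ) - + 5       ≡⟨ +m-+n≡+[m∸n] (ℕ.≤-trans (ℕ.n≤1+n 5) (ℕ.*-monoʳ-≤ 3 2≤ℓ)) ⟩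
  + (3 ℕ.* ℓ ℕ.∸ 5)       ∎
  where
  regroup : ∀ ℓ → + 3 * (ℓ - + 1) - + 2 ≡ + 3 * ℓ - + 5
  regroup = solve-∀

negG-natG≈intG : ∀ k → negG (natG k) ≈G intG (- + k)
negG-natG≈intG ℕ.zero  = ((λ ()) , (λ ())) , ((λ ()) , (λ ()))
negG-natG≈intG (suc k) = ≈G-refl _

pot-emptyCentre : ∀ {n} (f : Fin (suc n) → ℕ) → centre f ≡ 0 → pot f ≡ 3 ℕ.* leafTotal f
pot-emptyCentre f c≡0 = cong (λ c → 2 ℕ.* c +ℕ 3 ℕ.* leafTotal f) c≡0

starGame-emptyCentres : ∀ {n} (B R : Fin (suc n) → ℕ) → centre B ≡ 0 → centre R ≡ 0 →
  1 ≤ leafTotal B → 1 ≤ leafTotal R → LeavesSeparated B R ⊎ (Sparse B × Sparse R) →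
  starGame n B R ≈G
    ⟨ [ intG (+ (3 ℕ.* leafTotal B ℕ.∸ 5)) ] ∣ [ intG (- + (3 ℕ.* leafTotal R ℕ.∸ 5)) ] ⟩
starGame-emptyCentres {n} B R Bc≡0 Rc≡0 1≤Bℓ 1≤Rℓ leaves =
  ≈G-trans
    (subst₂ (λ p q → starGame n B R ≈G ⟨ [ natG (p ℕ.∸ 5) ] ∣ [ negG (natG (q ℕ.∸ 5)) ] ⟩)
            (pot-emptyCentre B Bc≡0) (pot-emptyCentre R Rc≡0)
            (emptyCentres (starGame-values B R (admissible-emptyCentres Bc≡0 Rc≡0 leaves)) Bc≡0 Rc≡0 1≤Bℓ 1≤Rℓ))
    (⟨∣⟩-cong (≈G-refl _) (negG-natG≈intG _))

theorem2 : ∀ (n : ℕ) → 1 ≤ n → (B R : Fin (suc n) → ℕ) →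
    -- (1) at least one pebble, all pebbles blue
    ((∀ v → R v ≡ 0) → 1 ≤ centre B +ℕ leafTotal B →
      starGame n B R ≈G intG (+ 3 * + leafTotal B - + 2 + + 2 * + centre B))
    ×
    -- (2) centre: ≥ 1 blue, no red; leaves: ≥ 1 blue and ≥ 1 red, on disjoint leaves
    (1 ≤ centre B → centre R ≡ 0 → 1 ≤ leafTotal B → 1 ≤ leafTotal R →
      LeavesSeparated B R →
      starGame n B R ≈G intG (+ 3 * + leafTotal B - + 2 + + 2 * (+ centre B - + 1)))
    ×
    -- (3) empty centre, exactly one blue and one red pebble on leaves
    (centre B ≡ 0 → centre R ≡ 0 → leafTotal B ≡ 1 → leafTotal R ≡ 1 →
      starGame n B R ≈G starG)
    ×
    -- (4) empty centre, ≥ 2 blue on leaves, exactly one red on another leaf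
    (centre B ≡ 0 → centre R ≡ 0 → 2 ≤ leafTotal B → leafTotal R ≡ 1 →
      LeavesSeparated B R →
      starGame n B R ≈G
        ⟨ [ intG (+ 3 * (+ leafTotal B - + 1) - + 2) ] ∣ [ intG (+ 0) ] ⟩)
    ×
    -- (5) empty centre, ≥ 2 blue and ≥ 2 red on disjoint collections of leaves
    (centre B ≡ 0 → centre R ≡ 0 → 2 ≤ leafTotal B → 2 ≤ leafTotal R →
      LeavesSeparated B R →
      starGame n B R ≈G
        ⟨ [ intG (+ 3 * (+ leafTotal B - + 1) - + 2) ]
        ∣ [ intG (- (+ 3 * (+ leafTotal R - + 1) - + 2)) ] ⟩)
theorem2 ℕ.zero () B R
theorem2 (suc n) _ B R =
  (λ noRed 1≤pebbles →
     subst (λ z → G ≈G intG z) (sym (allBlue-ℤ B (2≤pot B 1≤pebbles)))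
       (starGame-allBlue B R noRed zero)) ,
  (λ 1≤Bc Rc≡0 1≤Bℓ 1≤Rℓ sep →
     subst (λ z → G ≈G intG z) (sym (blueCentre-ℤ B (4≤pot B 1≤Bc 1≤Bℓ)))
       (blueCentre (starGame-values B R (admissible-blueCentre Rc≡0 1≤Bℓ sep)) 1≤Bc 1≤Rℓ)) ,
  (λ Bc≡0 Rc≡0 Bℓ≡1 Rℓ≡1 →
     subst₂ (λ p q → G ≈G ⟨ [ intG (+ (3 ℕ.* p ℕ.∸ 5)) ] ∣ [ intG (- + (3 ℕ.* q ℕ.∸ 5)) ] ⟩) Bℓ≡1 Rℓ≡1
       (starGame-emptyCentres B R Bc≡0 Rc≡0 (ℕ.≤-reflexive (sym Bℓ≡1)) (ℕ.≤-reflexive (sym Rℓ≡1))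
         (inj₂ (sparse B Bc≡0 Bℓ≡1 , sparse R Rc≡0 Rℓ≡1)))) ,
  (λ Bc≡0 Rc≡0 2≤Bℓ Rℓ≡1 sep →
     subst₂ (λ X Y → G ≈G ⟨ [ intG X ] ∣ [ intG Y ] ⟩)
       (sym (leaves-ℤ _ 2≤Bℓ)) (cong (λ q → - + (3 ℕ.* q ℕ.∸ 5)) Rℓ≡1)
       (starGame-emptyCentres B R Bc≡0 Rc≡0 (ℕ.<⇒≤ 2≤Bℓ) (ℕ.≤-reflexive (sym Rℓ≡1)) (inj₁ sep))) ,
  (λ Bc≡0 Rc≡0 2≤Bℓ 2≤Rℓ sep →
     subst₂ (λ X Y → G ≈G ⟨ [ intG X ] ∣ [ intG (- Y) ] ⟩)
       (sym (leaves-ℤ _ 2≤Bℓ)) (sym (leaves-ℤ _ 2≤Rℓ))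
       (starGame-emptyCentres B R Bc≡0 Rc≡0 (ℕ.<⇒≤ 2≤Bℓ) (ℕ.<⇒≤ 2≤Rℓ) (inj₁ sep)))
  where
  G : Game
  G = starGame (suc n) B R
  sparse : ∀ (f : Fin (suc (suc n)) → ℕ) → centre f ≡ 0 → leafTotal f ≡ 1 → Sparse f
  sparse f c≡0 ℓ≡1 = ℕ.≤-reflexive (cong₂ _+ℕ_ c≡0 ℓ≡1)
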